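{- Let $n$, $k$ and $t$ be integers with $k>t\geq 1$ and $n\geq 2(k-t)(t+1)\binom{k}{t}+k+t+1$. Then $$\mathrm{tw}(K(n,k,t))\leq \binom{n}{k}-\binom{n-t}{k-t}-1.$$
   Context: For integers $1\leq t<k\leq n$, the generalized Kneser graph $K(n,k,t)$ has as vertices the $k$-element subsets of $[n]=\{1,\dots,n\}$, two $k$-subsets $A,B$ being adjacent iff $|A\cap B|<t$. A tree decomposition of a graph $G$ is a pair $(T,(B_x)_{x\in V(T)})$ with $T$ a tree and each $B_x\subseteq V(G)$, such that for every $v\in V(G)$ the set of nodes $x$ with $v\in B_x$ induces a nonempty connected subtree of $T$, and every edge of $G$ has both endpoints in some $B_x$. Its width is $\max_x|B_x|-1$, and the treewidth $\mathrm{tw}(G)$ is the minimum width over all tree decompositions of $G$. -}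

module Defs where

open import Level using (0ℓ)
open import Data.Nat using (ℕ; _≤_; _<_; _+_; _*_; _∸_)
open import Data.Nat.Combinatorics using (_C_)
open import Data.Fin using (Fin)
open import Data.Fin.Subset using (Subset; _∩_; ∣_∣)
open import Data.List using (List; []; _∷_; _++_; length)
open import Data.List.Membership.Propositional using (_∈_)
open import Data.List.Relation.Unary.All using (All)
open import Data.List.Relation.Unary.Linked using (Linked)
open import Data.List.Relation.Unary.Unique.Propositional using (Unique)
open import Data.Product using (Σ; ∃; _×_)
open import Relation.Binary.PropositionalEquality using (_≡_)
open import Relation.Nullary using (¬_)
open import Data.Unit using (⊤)

KVertex : (n k : ℕ) → Subset n → Set
KVertex n k A = ∣ A ∣ ≡ k

KAdj : (n t : ℕ) → Subset n → Subset n → Set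
KAdj n t A B = ∣ A ∩ B ∣ < t

data Walk {V : Set} (Adj : V → V → Set) (P : V → Set) : V → V → Set where
  here : ∀ {x} → P x → Walk Adj P x x
  step : ∀ {x y z} → P x → Adj x y → Walk Adj P y z → Walk Adj P x z

ConnectedNonempty : {V : Set} → (V → V → Set) → (V → Set) → Set
ConnectedNonempty {V} Adj P =
  (Σ V P) × (∀ x y → P x → P y → Walk Adj P x y)

HasCycle : {V : Set} → (V → V → Set) → Set
HasCycle {V} Adj =
  Σ V λ x → Σ (List V) λ ys →
    (2 ≤ length ys) × Unique (x ∷ ys) × Linked Adj (x ∷ ys ++ x ∷ [])

record IsTree (m : ℕ) (TAdj : Fin m → Fin m → Set) : Set where
  field
    symmetric  : ∀ x y → TAdj x y → TAdj y x
    irreflexive : ∀ x → ¬ TAdj x x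
    connected  : ConnectedNonempty TAdj (λ _ → ⊤)
    acyclic    : ¬ HasCycle TAdj

-- Tree decompositions of a graph whose vertices are the elements of V
-- satisfying IsV, with adjacency Adj.  Bags are duplicate-free lists of
-- vertices, so the size of a bag is its length.
record TreeDecomposition {V : Set} (IsV : V → Set) (Adj : V → V → Set) : Set₁ where
  field
    m        : ℕ
    TAdj     : Fin m → Fin m → Set
    tree     : IsTree m TAdj
    bag      : Fin m → List V
    bagUnique : ∀ x → Unique (bag x)
    bagVerts : ∀ x → All IsV (bag x)
    vertexCond : ∀ v → IsV v → ConnectedNonempty TAdj (λ x → v ∈ bag x)
    edgeCond : ∀ u v → IsV u → IsV v → Adj u v →
               Σ (Fin m) λ x → (u ∈ bag x) × (v ∈ bag x)

WidthAtMost : {V : Set} {IsV : V → Set} {Adj : V → V → Set} →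
              TreeDecomposition IsV Adj → ℕ → Set
WidthAtMost D w = ∀ x → length (TreeDecomposition.bag D x) ≤ w + 1

TreewidthAtMost : {V : Set} → (V → Set) → (V → V → Set) → ℕ → Set₁
TreewidthAtMost IsV Adj w = Σ (TreeDecomposition IsV Adj) λ D → WidthAtMost D w

-- The k-sets containing {0,…,t-1} pairwise meet in at least t points, so they
-- form an independent set I of size C(n-t,k-t). Put all other vertices into
-- the centre of a star and give each A ∈ I a leaf whose bag is A together with
-- the centre minus one vertex A' that is not adjacent to A (remove 0 from A and
-- add the least point outside A, so |A ∩ A'| = k-1 ≥ t). Every bag then has at
-- most C(n,k) - C(n-t,k-t) vertices.
module Submission where

open import Defs
open import Data.Nat using (ℕ; _≤_; _<_; _+_; _*_; _∸_)
open import Data.Nat.Combinatorics using (_C_)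

open import Data.Nat using (zero; suc; z≤n; s≤s)
open import Data.Nat.Properties
  using (suc-injective; +-comm; +-suc; ≤-refl; m≤n+m∸n; m+n∸n≡m; ≤-trans; <-trans; <⇒≤; <⇒≱; m≤n+m; m≤m+n; <-≤-trans)
open import Data.Nat.Combinatorics using (nCk+nC[k+1]≡[n+1]C[k+1])
open import Level using (0ℓ)
open import Data.Bool using (Bool; true; false; T; _∧_) renaming (_≟_ to _≟ᵇ_)
open import Data.Unit using (⊤; tt)
open import Data.Empty using (⊥; ⊥-elim)
open import Data.Fin using (Fin; zero; suc)
open import Data.Fin.Subset using (Subset; _∩_; ∣_∣; inside; outside)
open import Data.Fin.Subset.Properties using (∩-comm; ∩-idem)
open import Data.Vec using ([]; _∷_)
open import Data.Vec.Properties using (≡-dec; ∷-injectiveʳ)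
open import Data.List using (List; []; _∷_; _++_; length; map; filter; lookup)
open import Data.List.Properties using (length-map; length-++; filter-++; filter-all; filter-none; filter-notAll)
open import Data.List.Membership.Propositional using (_∈_)
open import Data.List.Membership.Propositional.Properties
  using (∈-map⁺; ∈-map⁻; ∈-++⁺ˡ; ∈-++⁺ʳ; ∈-++⁻; ∈-filter⁺; ∈-filter⁻; ∈-lookup)
open import Data.List.Relation.Unary.Any as Any using (here; there; index)
open import Data.List.Relation.Unary.Any.Properties using (lookup-index)
open import Data.List.Relation.Unary.All as All using (All; []; _∷_)
open import Data.List.Relation.Unary.Linked using (Linked; _∷_)
open import Data.List.Relation.Unary.Unique.Propositional using (Unique; []; _∷_)
import Data.List.Relation.Unary.Unique.Propositional.Properties as Unique
open import Data.Product using (Σ; _×_; _,_; proj₁; proj₂)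
open import Data.Sum using (inj₁; inj₂)
open import Function using (_∘_)
open import Relation.Nullary using (¬_; yes; no; ¬?)
open import Relation.Nullary.Decidable using (T?)
open import Relation.Unary using (Pred; Decidable)
open import Relation.Unary.Properties using (∁?)
open import Relation.Binary.Definitions using (DecidableEquality)
open import Relation.Binary.PropositionalEquality
  using (_≡_; _≢_; refl; sym; trans; cong; cong₂; subst; module ≡-Reasoning)

module _ {A : Set} where

  lookup-injective : ∀ {xs : List A} → Unique xs → ∀ i j → lookup xs i ≡ lookup xs j → i ≡ j
  lookup-injective (_ ∷ _)  zero    zero    _  = refl
  lookup-injective (x∉ ∷ _) zero    (suc j) eq = ⊥-elim (All.lookup x∉ (∈-lookup j) eq)
  lookup-injective (x∉ ∷ _) (suc i) zero    eq = ⊥-elim (All.lookup x∉ (∈-lookup i) (sym eq))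
  lookup-injective (_ ∷ u)  (suc i) (suc j) eq = cong suc (lookup-injective u i j eq)

  module _ {P : Pred A 0ℓ} (P? : Decidable P) where

    length-filter-∁+length-filter : ∀ xs → length (filter (∁? P?) xs) + length (filter P? xs) ≡ length xs
    length-filter-∁+length-filter []       = refl
    length-filter-∁+length-filter (x ∷ xs) with P? x
    ... | yes _ = trans (+-suc _ _) (cong suc (length-filter-∁+length-filter xs))
    ... | no  _ = cong suc (length-filter-∁+length-filter xs)

    filter-map : ∀ {B : Set} (f : B → A) xs → filter P? (map f xs) ≡ map f (filter (P? ∘ f) xs)
    filter-map f []       = refl
    filter-map f (x ∷ xs) with P? (f x)
    ... | yes _ = cong (f x ∷_) (filter-map f xs)
    ... | no  _ = filter-map f xs

Star : ∀ {N} → Fin (suc N) → Fin (suc N) → Set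
Star zero    zero    = ⊥
Star zero    (suc _) = ⊤
Star (suc _) zero    = ⊤
Star (suc _) (suc _) = ⊥

star-walk : ∀ {N} (P : Fin (suc N) → Set) → P zero → ∀ x y → P x → P y → Walk Star P x y
star-walk P p₀ zero    zero    px py = here px
star-walk P p₀ zero    (suc _) px py = step p₀ tt (here py)
star-walk P p₀ (suc _) zero    px py = step px tt (here p₀)
star-walk P p₀ (suc _) (suc _) px py = step px tt (step p₀ tt (here py))

star-path-to-leaf-visits-centre : ∀ {N} {j : Fin N} x ys →
  Linked Star (x ∷ ys ++ suc j ∷ []) → zero ∈ x ∷ ys
star-path-to-leaf-visits-centre zero    ys       _       = here refl
star-path-to-leaf-visits-centre (suc _) []       (() ∷ _)
star-path-to-leaf-visits-centre (suc _) (y ∷ ys) (_ ∷ l) = there (star-path-to-leaf-visits-centre y ys l)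

-- Leaves are pairwise non-adjacent, so every other vertex of a cycle is the
-- centre, and a cycle of length at least 3 would visit it twice.
star-acyclic : ∀ {N} → ¬ HasCycle (Star {N})
star-acyclic (zero  , zero ∷ _ , _ , _ , (() ∷ _))
star-acyclic (zero  , suc _ ∷ [] , s≤s () , _ , _)
star-acyclic (zero  , suc _ ∷ suc _ ∷ _ , _ , _ , (_ ∷ (() ∷ _)))
star-acyclic (zero  , suc _ ∷ zero ∷ _ , _ , (_ ∷ (0≢0 ∷ _)) ∷ _ , _) = 0≢0 refl
star-acyclic (suc _ , suc _ ∷ _ , _ , _ , (() ∷ _))
star-acyclic (suc _ , zero ∷ [] , s≤s () , _ , _)
star-acyclic (suc _ , zero ∷ y ∷ ys , _ , _ ∷ (0∉ ∷ _) , (_ ∷ (_ ∷ l))) =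
  All.lookup 0∉ (star-path-to-leaf-visits-centre y ys l) refl

star-isTree : ∀ N → IsTree (suc N) Star
star-isTree N = record
  { symmetric   = symmetric
  ; irreflexive = irreflexive
  ; connected   = (zero , tt) , (λ x y _ _ → star-walk _ tt x y tt tt)
  ; acyclic     = star-acyclic
  }
  where
  symmetric : ∀ x y → Star x y → Star y x
  symmetric zero    (suc _) _ = tt
  symmetric (suc _) zero    _ = tt

  irreflexive : ∀ x → ¬ Star x x
  irreflexive zero    ()
  irreflexive (suc _) ()

module StarDecomposition
  {V : Set} (_≟_ : DecidableEquality V) {IsV : Pred V 0ℓ} {Adj : V → V → Set}
  (vertices : List V) (vertices-unique : Unique vertices)
  (vertices-sound : All IsV vertices) (vertices-complete : ∀ {v} → IsV v → v ∈ vertices)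
  {I : Pred V 0ℓ} (I? : Decidable I) (independent : ∀ {u v} → I u → I v → ¬ Adj u v)
  (partner : V → V)
  (partner-isV : ∀ {v} → IsV v → I v → IsV (partner v))
  (partner-∉I : ∀ {v} → IsV v → I v → ¬ I (partner v))
  (partner-¬adjʳ : ∀ {v} → IsV v → I v → ¬ Adj v (partner v))
  (partner-¬adjˡ : ∀ {v} → IsV v → I v → ¬ Adj (partner v) v)
  where

  centre : List V
  centre = filter (∁? I?) vertices

  members : List V
  members = filter I? vertices

  leaf : V → List V
  leaf v = v ∷ filter (λ u → ¬? (u ≟ partner v)) centre

  Node : Set
  Node = Fin (suc (length members))

  bag : Node → List V
  bag zero    = centre
  bag (suc i) = leaf (lookup members i)

  ∈centre⁺ : ∀ {v} → IsV v → ¬ I v → v ∈ centre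
  ∈centre⁺ v∈V = ∈-filter⁺ (∁? I?) (vertices-complete v∈V)

  ∈centre⁻ : ∀ {v} → v ∈ centre → IsV v × ¬ I v
  ∈centre⁻ p with v∈vs , v∉I ← ∈-filter⁻ (∁? I?) p = All.lookup vertices-sound v∈vs , v∉I

  ∈leaf⁺ : ∀ {u v} → u ∈ centre → u ≢ partner v → u ∈ leaf v
  ∈leaf⁺ p u≢ = there (∈-filter⁺ (λ u → ¬? (u ≟ partner _)) p u≢)

  ∈leaf-I : ∀ {u v} → u ∈ leaf v → I u → u ≡ v
  ∈leaf-I (here eq) _   = eq
  ∈leaf-I (there p) u∈I = ⊥-elim (proj₂ (∈centre⁻ (proj₁ (∈-filter⁻ _ p))) u∈I)

  member⁻ : ∀ i → IsV (lookup members i) × I (lookup members i)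
  member⁻ i with v∈vs , v∈I ← ∈-filter⁻ I? (∈-lookup i) = All.lookup vertices-sound v∈vs , v∈I

  leafNode : ∀ {v} → IsV v → I v → Node
  leafNode v∈V v∈I = suc (index (∈-filter⁺ I? (vertices-complete v∈V) v∈I))

  ∈bag-leafNode : ∀ {u v} (v∈V : IsV v) (v∈I : I v) → u ∈ leaf v → u ∈ bag (leafNode v∈V v∈I)
  ∈bag-leafNode v∈V v∈I = subst (λ w → _ ∈ leaf w) (lookup-index (∈-filter⁺ I? (vertices-complete v∈V) v∈I))

  leaf-unique : ∀ {v} → I v → Unique (leaf v)
  leaf-unique v∈I =
    All.tabulate (λ p v≡u → proj₂ (∈centre⁻ (proj₁ (∈-filter⁻ _ p))) (subst I v≡u v∈I))
    ∷ Unique.filter⁺ _ (Unique.filter⁺ (∁? I?) vertices-unique)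

  length-leaf : ∀ {v} → IsV v → I v → length (leaf v) ≤ length centre
  length-leaf v∈V v∈I =
    filter-notAll (λ u → ¬? (u ≟ partner _)) centre
      (Any.map (λ eq u≢ → u≢ (sym eq)) (∈centre⁺ (partner-isV v∈V v∈I) (partner-∉I v∈V v∈I)))

  bag-unique : ∀ x → Unique (bag x)
  bag-unique zero    = Unique.filter⁺ (∁? I?) vertices-unique
  bag-unique (suc i) = leaf-unique (proj₂ (member⁻ i))

  bag-sound : ∀ x → All IsV (bag x)
  bag-sound zero    = All.tabulate (proj₁ ∘ ∈centre⁻)
  bag-sound (suc i) = proj₁ (member⁻ i) ∷ All.tabulate (proj₁ ∘ ∈centre⁻ ∘ proj₁ ∘ ∈-filter⁻ _)

  length-bag : ∀ x → length (bag x) ≤ length centre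
  length-bag zero    = ≤-refl
  length-bag (suc i) = length-leaf (proj₁ (member⁻ i)) (proj₂ (member⁻ i))

  vertex-connected : ∀ v → IsV v → ConnectedNonempty Star (λ x → v ∈ bag x)
  vertex-connected v v∈V with I? v
  ... | no v∉I = (zero , v∈centre) , star-walk _ v∈centre
    where v∈centre = ∈centre⁺ v∈V v∉I
  ... | yes v∈I = (leafNode v∈V v∈I , ∈bag-leafNode v∈V v∈I (here refl)) , walk
    where
    walk : ∀ x y → v ∈ bag x → v ∈ bag y → Walk Star (λ x → v ∈ bag x) x y
    walk zero    _       p _ = ⊥-elim (proj₂ (∈centre⁻ p) v∈I)
    walk (suc _) zero    _ q = ⊥-elim (proj₂ (∈centre⁻ q) v∈I)
    walk (suc i) (suc j) p q
      with refl ← lookup-injective (Unique.filter⁺ I? vertices-unique) i j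
                    (trans (sym (∈leaf-I p v∈I)) (∈leaf-I q v∈I)) = here p

  edge-covered : ∀ u v → IsV u → IsV v → Adj u v → Σ Node λ x → u ∈ bag x × v ∈ bag x
  edge-covered u v u∈V v∈V uv with I? u | I? v
  ... | yes u∈I | yes v∈I = ⊥-elim (independent u∈I v∈I uv)
  ... | no  u∉I | no  v∉I = zero , ∈centre⁺ u∈V u∉I , ∈centre⁺ v∈V v∉I
  ... | yes u∈I | no  v∉I =
    leafNode u∈V u∈I , ∈bag-leafNode u∈V u∈I (here refl) ,
    ∈bag-leafNode u∈V u∈I (∈leaf⁺ (∈centre⁺ v∈V v∉I)
                                  (λ v≡ → partner-¬adjʳ u∈V u∈I (subst (Adj u) v≡ uv)))
  ... | no  u∉I | yes v∈I =
    leafNode v∈V v∈I ,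
    ∈bag-leafNode v∈V v∈I (∈leaf⁺ (∈centre⁺ u∈V u∉I)
                                  (λ u≡ → partner-¬adjˡ v∈V v∈I (subst (λ w → Adj w v) u≡ uv))) ,
    ∈bag-leafNode v∈V v∈I (here refl)

  decomposition : TreeDecomposition IsV Adj
  decomposition = record
    { m          = suc (length members)
    ; TAdj       = Star
    ; tree       = star-isTree (length members)
    ; bag        = bag
    ; bagUnique  = bag-unique
    ; bagVerts   = bag-sound
    ; vertexCond = vertex-connected
    ; edgeCond   = edge-covered
    }

  treewidth≤ : TreewidthAtMost IsV Adj (length centre ∸ 1)
  treewidth≤ = decomposition , λ x →
    ≤-trans (length-bag x) (subst (length centre ≤_) (+-comm 1 _) (m≤n+m∸n (length centre) 1))

kSubsets : ∀ n → ℕ → List (Subset n)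
kSubsets zero    zero    = [] ∷ []
kSubsets zero    (suc k) = []
kSubsets (suc n) zero    = map (outside ∷_) (kSubsets n zero)
kSubsets (suc n) (suc k) = map (outside ∷_) (kSubsets n (suc k)) ++ map (inside ∷_) (kSubsets n k)

∈kSubsets⁺ : ∀ {n} k (A : Subset n) → ∣ A ∣ ≡ k → A ∈ kSubsets n k
∈kSubsets⁺ zero    []            _  = here refl
∈kSubsets⁺ zero    (outside ∷ A) eq = ∈-map⁺ _ (∈kSubsets⁺ zero A eq)
∈kSubsets⁺ (suc k) (outside ∷ A) eq = ∈-++⁺ˡ (∈-map⁺ _ (∈kSubsets⁺ (suc k) A eq))
∈kSubsets⁺ (suc k) (inside ∷ A)  eq =
  ∈-++⁺ʳ (map (outside ∷_) (kSubsets _ (suc k))) (∈-map⁺ _ (∈kSubsets⁺ k A (suc-injective eq)))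

∈kSubsets⁻ : ∀ n k {A : Subset n} → A ∈ kSubsets n k → ∣ A ∣ ≡ k
∈kSubsets⁻ zero    zero    (here refl) = refl
∈kSubsets⁻ (suc n) zero    p with _ , q , refl ← ∈-map⁻ _ p = ∈kSubsets⁻ n zero q
∈kSubsets⁻ (suc n) (suc k) p with ∈-++⁻ (map (outside ∷_) (kSubsets n (suc k))) p
... | inj₁ p′ with _ , q , refl ← ∈-map⁻ _ p′ = ∈kSubsets⁻ n (suc k) q
... | inj₂ p′ with _ , q , refl ← ∈-map⁻ _ p′ = cong suc (∈kSubsets⁻ n k q)

kSubsets-unique : ∀ n k → Unique (kSubsets n k)
kSubsets-unique zero    zero    = [] ∷ []
kSubsets-unique zero    (suc k) = []
kSubsets-unique (suc n) zero    = Unique.map⁺ ∷-injectiveʳ (kSubsets-unique n zero)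
kSubsets-unique (suc n) (suc k) =
  Unique.++⁺ (Unique.map⁺ ∷-injectiveʳ (kSubsets-unique n (suc k)))
             (Unique.map⁺ ∷-injectiveʳ (kSubsets-unique n k))
             disjoint
  where
  disjoint : ∀ {A} → ¬ (A ∈ map (outside ∷_) (kSubsets n (suc k)) × A ∈ map (inside ∷_) (kSubsets n k))
  disjoint (p , q) with _ , _ , refl ← ∈-map⁻ _ p | _ , _ , () ← ∈-map⁻ _ q

length-kSubsets : ∀ n k → length (kSubsets n k) ≡ n C k
length-kSubsets zero    zero    = refl
length-kSubsets zero    (suc k) = refl
length-kSubsets (suc n) zero    = trans (length-map _ (kSubsets n zero)) (length-kSubsets n zero)
length-kSubsets (suc n) (suc k) = begin
  length (map (outside ∷_) (kSubsets n (suc k)) ++ map (inside ∷_) (kSubsets n k))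
    ≡⟨ length-++ (map (outside ∷_) (kSubsets n (suc k))) ⟩
  length (map (outside ∷_) (kSubsets n (suc k))) + length (map (inside ∷_) (kSubsets n k))
    ≡⟨ cong₂ _+_ (trans (length-map _ (kSubsets n (suc k))) (length-kSubsets n (suc k)))
                 (trans (length-map _ (kSubsets n k)) (length-kSubsets n k)) ⟩
  n C suc k + n C k
    ≡⟨ +-comm (n C suc k) (n C k) ⟩
  n C k + n C suc k
    ≡⟨ nCk+nC[k+1]≡[n+1]C[k+1] n k ⟩
  suc n C suc k ∎
  where open ≡-Reasoning

containsFirst : ∀ {n} → ℕ → Subset n → Bool
containsFirst zero    _       = true
containsFirst (suc t) []      = false
containsFirst (suc t) (b ∷ A) = b ∧ containsFirst t A

ContainsFirst : ∀ {n} → ℕ → Pred (Subset n) 0ℓ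
ContainsFirst t = T ∘ containsFirst t

containsFirst? : ∀ {n} t → Decidable (ContainsFirst {n} t)
containsFirst? t = T? ∘ containsFirst t

≤∣∩∣-containsFirst : ∀ {n} t {A B : Subset n} →
  ContainsFirst t A → ContainsFirst t B → t ≤ ∣ A ∩ B ∣
≤∣∩∣-containsFirst zero                                   _  _  = z≤n
≤∣∩∣-containsFirst (suc t) {inside ∷ _} {inside ∷ _} tA tB = s≤s (≤∣∩∣-containsFirst t tA tB)

filter-containsFirst-kSubsets : ∀ n k t →
  filter (containsFirst? (suc t)) (kSubsets (suc n) (suc k))
    ≡ map (inside ∷_) (filter (containsFirst? t) (kSubsets n k))
filter-containsFirst-kSubsets n k t = begin
  filter P? (map (outside ∷_) (kSubsets n (suc k)) ++ map (inside ∷_) (kSubsets n k))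
    ≡⟨ filter-++ P? (map (outside ∷_) (kSubsets n (suc k))) (map (inside ∷_) (kSubsets n k)) ⟩
  filter P? (map (outside ∷_) (kSubsets n (suc k))) ++ filter P? (map (inside ∷_) (kSubsets n k))
    ≡⟨ cong₂ _++_ (filter-map P? (outside ∷_) (kSubsets n (suc k))) (filter-map P? (inside ∷_) (kSubsets n k)) ⟩
  map (outside ∷_) (filter (λ _ → T? false) (kSubsets n (suc k))) ++
  map (inside ∷_) (filter (containsFirst? t) (kSubsets n k))
    ≡⟨ cong (λ xs → map (outside ∷_) xs ++ map (inside ∷_) (filter (containsFirst? t) (kSubsets n k)))
            (filter-none (λ _ → T? false) (All.universal (λ _ ()) (kSubsets n (suc k)))) ⟩
  map (inside ∷_) (filter (containsFirst? t) (kSubsets n k)) ∎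
  where
  open ≡-Reasoning
  P? = containsFirst? (suc t)

length-filter-containsFirst-kSubsets : ∀ n k t → t ≤ n → t ≤ k →
  length (filter (containsFirst? t) (kSubsets n k)) ≡ (n ∸ t) C (k ∸ t)
length-filter-containsFirst-kSubsets n k zero _ _ =
  trans (cong length (filter-all (containsFirst? zero) (All.universal _ (kSubsets n k))))
        (length-kSubsets n k)
length-filter-containsFirst-kSubsets (suc n) (suc k) (suc t) (s≤s t≤n) (s≤s t≤k) = begin
  length (filter (containsFirst? (suc t)) (kSubsets (suc n) (suc k)))
    ≡⟨ cong length (filter-containsFirst-kSubsets n k t) ⟩
  length (map (inside ∷_) (filter (containsFirst? t) (kSubsets n k)))
    ≡⟨ length-map (inside ∷_) (filter (containsFirst? t) (kSubsets n k)) ⟩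
  length (filter (containsFirst? t) (kSubsets n k))
    ≡⟨ length-filter-containsFirst-kSubsets n k t t≤n t≤k ⟩
  (n ∸ t) C (k ∸ t) ∎
  where open ≡-Reasoning

length-filter-∁containsFirst-kSubsets : ∀ n k t → t ≤ n → t ≤ k →
  length (filter (∁? (containsFirst? t)) (kSubsets n k)) ≡ n C k ∸ (n ∸ t) C (k ∸ t)
length-filter-∁containsFirst-kSubsets n k t t≤n t≤k =
  trans (sym (m+n∸n≡m outside-count inside-count)) (cong (_∸ inside-count) total)
  where
  open ≡-Reasoning
  P? = containsFirst? t
  outside-count = length (filter (∁? P?) (kSubsets n k))
  inside-count  = (n ∸ t) C (k ∸ t)

  total : outside-count + inside-count ≡ n C k
  total = begin
    outside-count + inside-count
      ≡⟨ cong (outside-count +_) (length-filter-containsFirst-kSubsets n k t t≤n t≤k) ⟨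
    outside-count + length (filter P? (kSubsets n k))
      ≡⟨ length-filter-∁+length-filter P? (kSubsets n k) ⟩
    length (kSubsets n k)
      ≡⟨ length-kSubsets n k ⟩
    n C k ∎

insertFirstAbsent : ∀ {n} → Subset n → Subset n
insertFirstAbsent []            = []
insertFirstAbsent (outside ∷ A) = inside ∷ A
insertFirstAbsent (inside ∷ A)  = inside ∷ insertFirstAbsent A

∣insertFirstAbsent∣ : ∀ {n} (A : Subset n) → ∣ A ∣ < n → ∣ insertFirstAbsent A ∣ ≡ suc ∣ A ∣
∣insertFirstAbsent∣ (outside ∷ A) _         = refl
∣insertFirstAbsent∣ (inside ∷ A)  (s≤s A<n) = cong suc (∣insertFirstAbsent∣ A A<n)

∩-insertFirstAbsent : ∀ {n} (A : Subset n) → A ∩ insertFirstAbsent A ≡ A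
∩-insertFirstAbsent []            = refl
∩-insertFirstAbsent (outside ∷ A) = cong (outside ∷_) (∩-idem A)
∩-insertFirstAbsent (inside ∷ A)  = cong (inside ∷_) (∩-insertFirstAbsent A)

swapOutZero : ∀ {n} → Subset n → Subset n
swapOutZero []      = []
swapOutZero (_ ∷ A) = outside ∷ insertFirstAbsent A

¬containsFirst-swapOutZero : ∀ {n} t (A : Subset n) → ¬ ContainsFirst (suc t) (swapOutZero A)
¬containsFirst-swapOutZero t []      ()
¬containsFirst-swapOutZero t (_ ∷ _) ()

∣swapOutZero∣ : ∀ {n} t (A : Subset n) → ContainsFirst (suc t) A → ∣ A ∣ < n → ∣ swapOutZero A ∣ ≡ ∣ A ∣
∣swapOutZero∣ t (inside ∷ A) _ (s≤s A<n) = ∣insertFirstAbsent∣ A A<n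

suc∣∩swapOutZero∣ : ∀ {n} t (A : Subset n) → ContainsFirst (suc t) A → suc ∣ A ∩ swapOutZero A ∣ ≡ ∣ A ∣
suc∣∩swapOutZero∣ t (inside ∷ A) _ = cong (suc ∘ ∣_∣) (∩-insertFirstAbsent A)

module KneserStar (n k s : ℕ) (s<k : suc s < k) (k<n : k < n) where

  suc∣∩∣≡k⇒¬adjacent : ∀ (A B : Subset n) → suc ∣ A ∩ B ∣ ≡ k → ¬ KAdj n (suc s) A B
  suc∣∩∣≡k⇒¬adjacent _ _ eq A∩B<t = <⇒≱ s<k (subst (_≤ suc s) eq A∩B<t)

  open StarDecomposition
    (≡-dec _≟ᵇ_) (kSubsets n k) (kSubsets-unique n k)
    (All.tabulate (∈kSubsets⁻ n k)) (∈kSubsets⁺ k _)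
    (containsFirst? (suc s))
    (λ {A} {B} tA tB A∩B<t → <⇒≱ A∩B<t (≤∣∩∣-containsFirst (suc s) {A} {B} tA tB))
    swapOutZero
    (λ {A} ∣A∣≡k 0∈A → trans (∣swapOutZero∣ s A 0∈A (subst (_< n) (sym ∣A∣≡k) k<n)) ∣A∣≡k)
    (λ {A} _ _ → ¬containsFirst-swapOutZero s A)
    (λ {A} ∣A∣≡k 0∈A → suc∣∩∣≡k⇒¬adjacent A (swapOutZero A) (trans (suc∣∩swapOutZero∣ s A 0∈A) ∣A∣≡k))
    (λ {A} ∣A∣≡k 0∈A → suc∣∩∣≡k⇒¬adjacent (swapOutZero A) A
      (trans (cong (suc ∘ ∣_∣) (∩-comm (swapOutZero A) A)) (trans (suc∣∩swapOutZero∣ s A 0∈A) ∣A∣≡k)))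
    public using (treewidth≤)

lemma3p3 : (n k t : ℕ) → 1 ≤ t → t < k →
    2 * (k ∸ t) * (t + 1) * (k C t) + k + t + 1 ≤ n →
    TreewidthAtMost (KVertex n k) (KAdj n t) ((n C k) ∸ ((n ∸ t) C (k ∸ t)) ∸ 1)
lemma3p3 n k (suc s) _ t<k n-large =
  subst (TreewidthAtMost (KVertex n k) (KAdj n (suc s)))
        (cong (_∸ 1) (length-filter-∁containsFirst-kSubsets n k (suc s) (<⇒≤ (<-trans t<k k<n)) (<⇒≤ t<k)))
        (KneserStar.treewidth≤ n k s t<k k<n)
  where
  X = 2 * (k ∸ suc s) * (suc s + 1) * (k C suc s)
  k<n : k < n
  k<n = <-≤-trans (s≤s (≤-trans (m≤n+m k X) (m≤m+n (X + k) (suc s))))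
                  (subst (_≤ n) (+-comm (X + k + suc s) 1) n-large)
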